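{- Let $\mathbb{F}_q$ be a finite field, $r$ a prime divisor of $q-1$, $\rho\in\mathbb{F}_q$ a primitive $r$-th root of unity, $\alpha\in\mathbb{F}_q^\times$ and $\beta=\alpha^r$. Let $a\in\mathbb{F}_q$ with $a^r\neq\beta$, and for $0\leq i<r$ let $c_i=\frac{a-\rho^i\alpha}{a-\rho^{i+1}\alpha}\in\mathbb{F}_q^\times$ and let $d_i$ be the multiplicative order of $c_i$ in $\mathbb{F}_q^\times$. For a positive integer $k$ let $g_{a,k}(x)=(a-x)^k-(a-\rho x)^k\in\mathbb{F}_q[x]$. Then: (1) $d_i\mid k$ for all $0\leq i<r$ if and only if $g_{a,k}(x)\equiv 0\pmod{x^r-\beta}$; (2) there exist $i,j$ with $d_i\mid k$ and $d_j\nmid k$ if and only if $\gcd(g_{a,k}(x),x^r-\beta)$ is a non-trivial factor of $x^r-\beta$; (3) $d_i\nmid k$ for all $0\leq i<r$ if and only if $\gcd(g_{a,k}(x),x^r-\beta)=1$.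
   Context: The gcd is the monic gcd in $\mathbb{F}_q[x]$; a non-trivial factor is one of degree strictly between $0$ and $r$. -}

module Defs where

open import Level using (Level; _⊔_) renaming (suc to lsuc)
open import Algebra.Bundles using (CommutativeRing)
open import Data.Nat using (ℕ; zero; suc; _<_; _≤_)
open import Data.Fin using (Fin)
open import Data.List using (List; []; _∷_; replicate; _++_; map)
open import Data.Product using (Σ; ∃; _×_; _,_)
open import Relation.Nullary using (¬_)
open import Relation.Binary.PropositionalEquality using (_≡_)

record FiniteField (c ℓ : Level) : Set (lsuc (c ⊔ ℓ)) where
  infix 8 _⁻¹
  field
    commutativeRing : CommutativeRing c ℓ
  open CommutativeRing commutativeRing public
  field
    0≉1        : ¬ (0# ≈ 1#)
    _⁻¹        : Carrier → Carrier
    ⁻¹-inverse : ∀ x → ¬ (x ≈ 0#) → (x * (x ⁻¹)) ≈ 1#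
    size       : ℕ
    enum       : Fin size → Carrier
    enum-surj  : ∀ x → ∃ λ i → enum i ≈ x
    enum-inj   : ∀ i j → enum i ≈ enum j → i ≡ j

module FF {c ℓ : Level} (F : FiniteField c ℓ) where
  open FiniteField F public

  q : ℕ
  q = size

  pow : Carrier → ℕ → Carrier
  pow x zero    = 1#
  pow x (suc n) = x * pow x n

  IsPrimitiveRoot : Carrier → ℕ → Set ℓ
  IsPrimitiveRoot ρ r = pow ρ r ≈ 1# × (∀ m → 0 < m → m < r → ¬ (pow ρ m ≈ 1#))

  IsMultOrder : Carrier → ℕ → Set ℓ
  IsMultOrder x d = 0 < d × pow x d ≈ 1# × (∀ m → 0 < m → pow x m ≈ 1# → d ≤ m)

  cc : (ρ α a : Carrier) → ℕ → Carrier
  cc ρ α a i = (a - pow ρ i * α) * ((a - pow ρ (suc i) * α) ⁻¹)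

  -- Polynomials: coefficient lists, lowest degree first.

  Poly : Set c
  Poly = List Carrier

  coeff : Poly → ℕ → Carrier
  coeff []      n       = 0#
  coeff (a ∷ p) zero    = a
  coeff (a ∷ p) (suc n) = coeff p n

  infix 4 _≈ₚ_
  _≈ₚ_ : Poly → Poly → Set ℓ
  p ≈ₚ r = ∀ n → coeff p n ≈ coeff r n

  infixl 6 _+ₚ_ _-ₚ_
  infixl 7 _*ₚ_
  _+ₚ_ : Poly → Poly → Poly
  []      +ₚ r       = r
  (a ∷ p) +ₚ []      = a ∷ p
  (a ∷ p) +ₚ (b ∷ r) = (a + b) ∷ (p +ₚ r)

  -ₚ_ : Poly → Poly
  -ₚ p = map -_ p

  _-ₚ_ : Poly → Poly → Poly
  p -ₚ r = p +ₚ (-ₚ r)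

  _*ₚ_ : Poly → Poly → Poly
  []      *ₚ r = []
  (a ∷ p) *ₚ r = map (a *_) r +ₚ (0# ∷ (p *ₚ r))

  oneₚ : Poly
  oneₚ = 1# ∷ []

  powₚ : Poly → ℕ → Poly
  powₚ p zero    = oneₚ
  powₚ p (suc n) = p *ₚ powₚ p n

  Xpow : ℕ → Poly
  Xpow n = replicate n 0# ++ (1# ∷ [])

  infix 4 _∣ₚ_
  _∣ₚ_ : Poly → Poly → Set (c ⊔ ℓ)
  p ∣ₚ r = ∃ λ h → r ≈ₚ h *ₚ p

  HasDegree : Poly → ℕ → Set ℓ
  HasDegree p n = ¬ (coeff p n ≈ 0#) × (∀ m → n < m → coeff p m ≈ 0#)

  Monic : Poly → Set ℓ
  Monic p = ∃ λ n → HasDegree p n × coeff p n ≈ 1#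

  IsMonicGCD : Poly → Poly → Poly → Set (c ⊔ ℓ)
  IsMonicGCD d f g =
    Monic d × d ∣ₚ f × d ∣ₚ g × (∀ e → e ∣ₚ f → e ∣ₚ g → e ∣ₚ d)

  XrMinus : ℕ → Carrier → Poly
  XrMinus r β = Xpow r -ₚ (β ∷ [])

  gak : (ρ a : Carrier) → ℕ → Poly
  gak ρ a k = powₚ (a ∷ (- 1#) ∷ []) k -ₚ powₚ (a ∷ (- ρ) ∷ []) k

  NonTrivialDeg : Poly → ℕ → Set ℓ
  NonTrivialDeg d r = ∃ λ n → HasDegree d n × 0 < n × n < r

{-# OPTIONS --safe #-}
-- The roots of f = x^r - β are the r distinct elements θ_i = ρ^i α, and f is
-- monic, so a polynomial is divisible by f iff it vanishes at every θ_i; hence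
-- a monic divisor of f vanishing at no θ_i is 1, and one vanishing at all of
-- them has degree r (and conversely).  The gcd D vanishes at θ_i exactly when
-- g = g_{a,k} does, and since ρ θ_i = ρ^(i+1) α,
-- g(θ_i) = (a - ρ^i α)^k - (a - ρ^(i+1) α)^k vanishes iff c_i^k = 1, i.e. d_i ∣ k.
module Submission where

open import Defs
open import Level using (Level)
open import Data.Nat as ℕ using (ℕ; zero; suc; _<_; _≤_; z≤n; s≤s; _∸_)
import Data.Nat.Properties as ℕ
open import Data.Nat.Divisibility using (_∣_; divides; m%n≡0⇒n∣m)
open import Data.Nat.DivMod using (_%_; _/_; m%n<n; m≡m%n+[m/n]*n)
open import Data.Nat.Primality using (Prime; ¬prime[0])
open import Data.Fin as Fin using (Fin; toℕ)
import Data.Fin.Properties as Fin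
open import Data.List using ([]; _∷_; map)
open import Data.Product using (∃; ∃₂; _×_; _,_; proj₁; proj₂)
open import Data.Sum using (inj₁; inj₂)
open import Data.Empty using (⊥-elim)
open import Data.Maybe using (nothing)
open import Function.Base using (_∘_)
open import Function.Bundles using (_⇔_; mk⇔; Equivalence)
import Function.Properties.Equivalence as ⇔
open import Relation.Nullary using (¬_; Dec; yes; no; ¬?)
open import Relation.Nullary.Decidable as Dec using (decidable-stable)
open import Relation.Binary.Definitions using (Decidable; tri<; tri≈; tri>)
open import Relation.Binary.PropositionalEquality as ≡ using (_≡_; _≢_)
open import Tactic.RingSolver.Core.AlmostCommutativeRing using (fromCommutativeRing)

module Polynomials {c ℓ : Level} (F : FiniteField c ℓ) where
  open FF F hiding (zero)
  open import Relation.Binary.Reasoning.Setoid setoid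
  open import Algebra.Properties.Ring ring
    using (-0#≈0#; -‿distribˡ-*; -‿distribʳ-*; -‿+-comm; x∙y⁻¹≈ε⇒x≈y; x≈y⇒x∙y⁻¹≈ε)
  open import Algebra.Properties.CommutativeSemiring.Exp commutativeSemiring
    using (_^_; ^-congˡ; ^-homo-*; ^-assocʳ; ^-distrib-*)
  open import Tactic.RingSolver.NonReflective (fromCommutativeRing commutativeRing (λ _ → nothing))

  x-y≈0⇒x≈y : ∀ {x y} → x - y ≈ 0# → x ≈ y
  x-y≈0⇒x≈y = x∙y⁻¹≈ε⇒x≈y _ _

  x≈y⇒x-y≈0 : ∀ {x y} → x ≈ y → x - y ≈ 0#
  x≈y⇒x-y≈0 = x≈y⇒x∙y⁻¹≈ε

  x-y≈0⇔x≈y : ∀ {x y} → x - y ≈ 0# ⇔ x ≈ y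
  x-y≈0⇔x≈y = mk⇔ x-y≈0⇒x≈y x≈y⇒x-y≈0

  1≉0 : ¬ (1# ≈ 0#)
  1≉0 1≈0 = 0≉1 (sym 1≈0)

  _≟_ : Decidable _≈_
  x ≟ y with enum-surj x | enum-surj y
  ... | i , i↦x | j , j↦y = Dec.map′ (λ i≡j → trans (sym i↦x) (≡.subst (λ l → enum l ≈ y) (≡.sym i≡j) j↦y))
                                     (λ x≈y → enum-inj i j (trans i↦x (trans x≈y (sym j↦y))))
                                     (i Fin.≟ j)

  x*y≈0⇒y≈0 : ∀ {x y} → ¬ (x ≈ 0#) → x * y ≈ 0# → y ≈ 0#
  x*y≈0⇒y≈0 {x} {y} x≉0 xy≈0 = begin
    y                 ≈⟨ sym (*-identityˡ y) ⟩
    1# * y            ≈⟨ *-congʳ (sym (trans (*-comm _ _) (⁻¹-inverse x x≉0))) ⟩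
    (x ⁻¹ * x) * y    ≈⟨ *-assoc (x ⁻¹) x y ⟩
    x ⁻¹ * (x * y)    ≈⟨ *-congˡ xy≈0 ⟩
    x ⁻¹ * 0#         ≈⟨ zeroʳ _ ⟩
    0#                ∎

  x*y≈0⇒x≈0 : ∀ {x y} → ¬ (y ≈ 0#) → x * y ≈ 0# → x ≈ 0#
  x*y≈0⇒x≈0 y≉0 xy≈0 = x*y≈0⇒y≈0 y≉0 (trans (*-comm _ _) xy≈0)

  *-cancelʳ-≉0 : ∀ {x y z} → ¬ (x ≈ 0#) → y * x ≈ z * x → y ≈ z
  *-cancelʳ-≉0 {x} {y} {z} x≉0 yx≈zx = x-y≈0⇒x≈y (x*y≈0⇒x≈0 x≉0 (begin
    (y - z) * x            ≈⟨ distribʳ x y (- z) ⟩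
    y * x + - z * x        ≈⟨ +-congˡ (sym (-‿distribˡ-* z x)) ⟩
    y * x - z * x          ≈⟨ x≈y⇒x-y≈0 yx≈zx ⟩
    0#                     ∎))

  pow≡^ : ∀ x n → pow x n ≡ x ^ n
  pow≡^ x zero    = ≡.refl
  pow≡^ x (suc n) = ≡.cong (x *_) (pow≡^ x n)

  pow-cong : ∀ {x y} n → x ≈ y → pow x n ≈ pow y n
  pow-cong {x} {y} n x≈y rewrite pow≡^ x n | pow≡^ y n = ^-congˡ n x≈y

  pow-+ : ∀ x m n → pow x (m ℕ.+ n) ≈ pow x m * pow x n
  pow-+ x m n rewrite pow≡^ x (m ℕ.+ n) | pow≡^ x m | pow≡^ x n = ^-homo-* x m n

  pow-* : ∀ x m n → pow (pow x m) n ≈ pow x (m ℕ.* n)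
  pow-* x m n rewrite pow≡^ (pow x m) n | pow≡^ x m | pow≡^ x (m ℕ.* n) = ^-assocʳ x m n

  pow-distrib-* : ∀ x y n → pow (x * y) n ≈ pow x n * pow y n
  pow-distrib-* x y n rewrite pow≡^ (x * y) n | pow≡^ x n | pow≡^ y n = ^-distrib-* x y n

  pow-1 : ∀ n → pow 1# n ≈ 1#
  pow-1 zero    = refl
  pow-1 (suc n) = trans (*-identityˡ _) (pow-1 n)

  pow-≉0 : ∀ {x} n → ¬ (x ≈ 0#) → ¬ (pow x n ≈ 0#)
  pow-≉0 zero    x≉0 = 1≉0
  pow-≉0 (suc n) x≉0 xxⁿ≈0 = pow-≉0 n x≉0 (x*y≈0⇒y≈0 x≉0 xxⁿ≈0)

  pow-ratio≈1⇔ : ∀ {u v} k → ¬ (v ≈ 0#) → pow (u * v ⁻¹) k ≈ 1# ⇔ pow u k ≈ pow v k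
  pow-ratio≈1⇔ {u} {v} k v≉0 = mk⇔
    (λ w≈1 → trans (sym ratio) (trans (*-congʳ w≈1) (*-identityˡ _)))
    (λ uᵏ≈vᵏ → *-cancelʳ-≉0 (pow-≉0 k v≉0) (trans ratio (trans uᵏ≈vᵏ (sym (*-identityˡ _)))))
    where
    ratio : pow (u * v ⁻¹) k * pow v k ≈ pow u k
    ratio = begin
      pow (u * v ⁻¹) k * pow v k   ≈⟨ sym (pow-distrib-* _ v k) ⟩
      pow (u * v ⁻¹ * v) k         ≈⟨ pow-cong k (trans (*-assoc u _ v) (trans (*-congˡ (trans (*-comm _ v) (⁻¹-inverse v v≉0))) (*-identityʳ u))) ⟩
      pow u k                      ∎

  ∣⇔pow≈1 : ∀ {x d} k → IsMultOrder x d → d ∣ k ⇔ pow x k ≈ 1#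
  ∣⇔pow≈1 {d = zero}        k (() , _)
  ∣⇔pow≈1 {x} {d@(suc d′)} k (_ , xᵈ≈1 , minimal) = mk⇔ ∣⇒pow≈1 pow≈1⇒∣
    where
    ∣⇒pow≈1 : ∀ {m} → d ∣ m → pow x m ≈ 1#
    ∣⇒pow≈1 (divides t ≡.refl) = begin
      pow x (t ℕ.* d)     ≡⟨ ≡.cong (pow x) (ℕ.*-comm t d) ⟩
      pow x (d ℕ.* t)     ≈⟨ sym (pow-* x d t) ⟩
      pow (pow x d) t     ≈⟨ pow-cong t xᵈ≈1 ⟩
      pow 1# t            ≈⟨ pow-1 t ⟩
      1#                  ∎
    pow≈1⇒∣ : pow x k ≈ 1# → d ∣ k
    pow≈1⇒∣ xᵏ≈1 with k % d in k%d≡s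
    ... | zero  = m%n≡0⇒n∣m k d k%d≡s
    ... | suc s = ⊥-elim (ℕ.<⇒≱ (≡.subst (_< d) k%d≡s (m%n<n k d)) (minimal (suc s) (s≤s z≤n) remainder≈1))
      where
      remainder≈1 : pow x (suc s) ≈ 1#
      remainder≈1 = begin
        pow x (suc s)                      ≈⟨ sym (*-identityʳ _) ⟩
        pow x (suc s) * 1#                 ≈⟨ *-congˡ (sym (∣⇒pow≈1 (divides (k / d) ≡.refl))) ⟩
        pow x (suc s) * pow x (k / d ℕ.* d) ≈⟨ sym (pow-+ x (suc s) _) ⟩
        pow x (suc s ℕ.+ k / d ℕ.* d)      ≡⟨ ≡.cong (λ m → pow x (m ℕ.+ k / d ℕ.* d)) (≡.sym k%d≡s) ⟩
        pow x (k % d ℕ.+ k / d ℕ.* d)      ≡⟨ ≡.cong (pow x) (≡.sym (m≡m%n+[m/n]*n k d)) ⟩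
        pow x k                            ≈⟨ xᵏ≈1 ⟩
        1#                                 ∎

  ≈ₚ-sym : ∀ {p r} → p ≈ₚ r → r ≈ₚ p
  ≈ₚ-sym p≈r n = sym (p≈r n)

  ≈ₚ-trans : ∀ {p r s} → p ≈ₚ r → r ≈ₚ s → p ≈ₚ s
  ≈ₚ-trans p≈r r≈s n = trans (p≈r n) (r≈s n)

  coeff-+ₚ : ∀ p r n → coeff (p +ₚ r) n ≈ coeff p n + coeff r n
  coeff-+ₚ []      r       n       = sym (+-identityˡ _)
  coeff-+ₚ (a ∷ p) []      n       = sym (+-identityʳ _)
  coeff-+ₚ (a ∷ p) (b ∷ r) zero    = refl
  coeff-+ₚ (a ∷ p) (b ∷ r) (suc n) = coeff-+ₚ p r n

  coeff-map : ∀ (f : Carrier → Carrier) → f 0# ≈ 0# → ∀ p n → coeff (map f p) n ≈ f (coeff p n)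
  coeff-map f f0≈0 []      n       = sym f0≈0
  coeff-map f f0≈0 (a ∷ p) zero    = refl
  coeff-map f f0≈0 (a ∷ p) (suc n) = coeff-map f f0≈0 p n

  coeff-scale : ∀ a p n → coeff (map (a *_) p) n ≈ a * coeff p n
  coeff-scale a = coeff-map (a *_) (zeroʳ a)

  coeff--ₚ : ∀ p r n → coeff (p -ₚ r) n ≈ coeff p n - coeff r n
  coeff--ₚ p r n = trans (coeff-+ₚ p (-ₚ r) n) (+-congˡ (coeff-map -_ -0#≈0# r n))

  coeff-*ₚ-zero : ∀ a p r → coeff ((a ∷ p) *ₚ r) zero ≈ a * coeff r zero
  coeff-*ₚ-zero a p r = trans (coeff-+ₚ (map (a *_) r) (0# ∷ p *ₚ r) zero)
                              (trans (+-identityʳ _) (coeff-scale a r zero))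

  coeff-*ₚ-suc : ∀ a p r n → coeff ((a ∷ p) *ₚ r) (suc n) ≈ a * coeff r (suc n) + coeff (p *ₚ r) n
  coeff-*ₚ-suc a p r n = trans (coeff-+ₚ (map (a *_) r) (0# ∷ p *ₚ r) (suc n))
                               (+-congʳ (coeff-scale a r (suc n)))

  *ₚ-zeroˡ : ∀ p r → p ≈ₚ [] → p *ₚ r ≈ₚ []
  *ₚ-zeroˡ []      r p≈0 n       = refl
  *ₚ-zeroˡ (a ∷ p) r p≈0 zero    = trans (coeff-*ₚ-zero a p r) (trans (*-congʳ (p≈0 zero)) (zeroˡ _))
  *ₚ-zeroˡ (a ∷ p) r p≈0 (suc n) = trans (coeff-*ₚ-suc a p r n)
    (trans (+-cong (trans (*-congʳ (p≈0 zero)) (zeroˡ _)) (*ₚ-zeroˡ p r (p≈0 ∘ suc) n)) (+-identityˡ 0#))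

  eval : Poly → Carrier → Carrier
  eval []      x = 0#
  eval (a ∷ p) x = a + x * eval p x

  eval-[] : ∀ {p} x → p ≈ₚ [] → eval p x ≈ 0#
  eval-[] {[]}    x p≈0 = refl
  eval-[] {a ∷ p} x p≈0 =
    trans (+-cong (p≈0 zero) (trans (*-congˡ (eval-[] {p} x (p≈0 ∘ suc))) (zeroʳ x))) (+-identityˡ 0#)

  eval-cong : ∀ {p r} x → p ≈ₚ r → eval p x ≈ eval r x
  eval-cong {[]}    {r}     x p≈r = sym (eval-[] {r} x (≈ₚ-sym {[]} {r} p≈r))
  eval-cong {a ∷ p} {[]}    x p≈r = eval-[] {a ∷ p} x p≈r
  eval-cong {a ∷ p} {b ∷ r} x p≈r = +-cong (p≈r zero) (*-congˡ (eval-cong {p} {r} x (p≈r ∘ suc)))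

  eval-const : ∀ b x → eval (b ∷ []) x ≈ b
  eval-const b x = trans (+-congˡ (zeroʳ x)) (+-identityʳ b)

  eval-+ₚ : ∀ p r x → eval (p +ₚ r) x ≈ eval p x + eval r x
  eval-+ₚ []      r       x = sym (+-identityˡ _)
  eval-+ₚ (a ∷ p) []      x = sym (+-identityʳ _)
  eval-+ₚ (a ∷ p) (b ∷ r) x = begin
    (a + b) + x * eval (p +ₚ r) x            ≈⟨ +-congˡ (*-congˡ (eval-+ₚ p r x)) ⟩
    (a + b) + x * (eval p x + eval r x)      ≈⟨ solve 5 (λ a b x P R → ((a ⊕ b) ⊕ (x ⊗ (P ⊕ R))) ⊜ ((a ⊕ (x ⊗ P)) ⊕ (b ⊕ (x ⊗ R)))) refl a b x (eval p x) (eval r x) ⟩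
    (a + x * eval p x) + (b + x * eval r x)  ∎

  eval-map : ∀ (f : Carrier → Carrier) → f 0# ≈ 0# → (∀ x y → f (x * y) ≈ x * f y) →
             (∀ x y → f (x + y) ≈ f x + f y) → ∀ p x → eval (map f p) x ≈ f (eval p x)
  eval-map f f0≈0 f-* f-+ []      x = sym f0≈0
  eval-map f f0≈0 f-* f-+ (a ∷ p) x = begin
    f a + x * eval (map f p) x   ≈⟨ +-congˡ (*-congˡ (eval-map f f0≈0 f-* f-+ p x)) ⟩
    f a + x * f (eval p x)       ≈⟨ +-congˡ (sym (f-* x _)) ⟩
    f a + f (x * eval p x)       ≈⟨ sym (f-+ a _) ⟩
    f (a + x * eval p x)         ∎

  eval-scale : ∀ b p x → eval (map (b *_) p) x ≈ b * eval p x
  eval-scale b = eval-map (b *_) (zeroʳ b)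
    (λ x y → trans (sym (*-assoc b x y)) (trans (*-congʳ (*-comm b x)) (*-assoc x b y))) (distribˡ b)

  eval--ₚ : ∀ p r x → eval (p -ₚ r) x ≈ eval p x - eval r x
  eval--ₚ p r x = trans (eval-+ₚ p (-ₚ r) x)
    (+-congˡ (eval-map -_ -0#≈0# (λ x y → -‿distribʳ-* x y) (λ x y → sym (-‿+-comm x y)) r x))

  eval-*ₚ : ∀ p r x → eval (p *ₚ r) x ≈ eval p x * eval r x
  eval-*ₚ []      r x = sym (zeroˡ _)
  eval-*ₚ (a ∷ p) r x = begin
    eval (map (a *_) r +ₚ (0# ∷ p *ₚ r)) x              ≈⟨ eval-+ₚ (map (a *_) r) (0# ∷ p *ₚ r) x ⟩
    eval (map (a *_) r) x + (0# + x * eval (p *ₚ r) x)  ≈⟨ +-cong (eval-scale a r x) (+-identityˡ _) ⟩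
    a * eval r x + x * eval (p *ₚ r) x                  ≈⟨ +-congˡ (*-congˡ (eval-*ₚ p r x)) ⟩
    a * eval r x + x * (eval p x * eval r x)            ≈⟨ +-congˡ (sym (*-assoc x _ _)) ⟩
    a * eval r x + (x * eval p x) * eval r x            ≈⟨ sym (distribʳ (eval r x) a _) ⟩
    (a + x * eval p x) * eval r x                       ∎

  eval-powₚ : ∀ p k x → eval (powₚ p k) x ≈ pow (eval p x) k
  eval-powₚ p zero    x = eval-const 1# x
  eval-powₚ p (suc k) x = trans (eval-*ₚ p (powₚ p k) x) (*-congˡ (eval-powₚ p k x))

  eval-Xpow : ∀ n x → eval (Xpow n) x ≈ pow x n
  eval-Xpow zero    x = eval-const 1# x
  eval-Xpow (suc n) x = trans (+-identityˡ _) (*-congˡ (eval-Xpow n x))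

  eval-factor : ∀ {p h f} x → p ≈ₚ h *ₚ f → eval p x ≈ eval h x * eval f x
  eval-factor {p} {h} {f} x p≈hf = trans (eval-cong {p} {h *ₚ f} x p≈hf) (eval-*ₚ h f x)

  root-of-factor : ∀ {p f} x → f ∣ₚ p → eval f x ≈ 0# → eval p x ≈ 0#
  root-of-factor {p} {f} x (h , p≈hf) fx≈0 = trans (eval-factor {p} {h} {f} x p≈hf) (trans (*-congˡ fx≈0) (zeroʳ _))

  DegreeBelow : Poly → ℕ → Set ℓ
  DegreeBelow p b = ∀ m → b ≤ m → coeff p m ≈ 0#

  ≈[]? : ∀ p → Dec (p ≈ₚ [])
  ≈[]? []      = yes (λ n → refl)
  ≈[]? (a ∷ p) with a ≟ 0# | ≈[]? p
  ... | yes a≈0 | yes p≈0 = yes λ { zero → a≈0 ; (suc n) → p≈0 n }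
  ... | no  a≉0 | _       = no (λ a∷p≈0 → a≉0 (a∷p≈0 zero))
  ... | _       | no  p≉0 = no (λ a∷p≈0 → p≉0 (a∷p≈0 ∘ suc))

  ≉[]⇒HasDegree : ∀ p → ¬ (p ≈ₚ []) → ∃ (HasDegree p)
  ≉[]⇒HasDegree []      p≉0 = ⊥-elim (p≉0 (λ n → refl))
  ≉[]⇒HasDegree (a ∷ p) a∷p≉0 with ≈[]? p
  ... | yes p≈0 = 0 , (λ a≈0 → a∷p≉0 λ { zero → a≈0 ; (suc n) → p≈0 n })
                    , λ { (suc m) _ → p≈0 m }
  ... | no  p≉0 with ≉[]⇒HasDegree p p≉0
  ...   | n , lead≉0 , above≈0 = suc n , lead≉0 , λ { (suc m) (s≤s n<m) → above≈0 m n<m }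

  HasDegree⇒≉[] : ∀ {p n} → HasDegree p n → ¬ (p ≈ₚ [])
  HasDegree⇒≉[] (lead≉0 , _) p≈0 = lead≉0 (p≈0 _)

  HasDegree-cong : ∀ {p r n} → p ≈ₚ r → HasDegree p n → HasDegree r n
  HasDegree-cong p≈r (lead≉0 , above≈0) =
    (λ lead≈0 → lead≉0 (trans (p≈r _) lead≈0)) , λ m n<m → trans (sym (p≈r m)) (above≈0 m n<m)

  HasDegree-unique : ∀ {p m n} → HasDegree p m → HasDegree p n → m ≡ n
  HasDegree-unique {m = m} {n} (lead≉0 , above≈0) (lead′≉0 , above′≈0) with ℕ.<-cmp m n
  ... | tri< m<n _ _ = ⊥-elim (lead′≉0 (above≈0 n m<n))
  ... | tri≈ _ m≡n _ = m≡n
  ... | tri> _ _ n<m = ⊥-elim (lead≉0 (above′≈0 m n<m))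

  DegreeBelow⇒< : ∀ {p b n} → DegreeBelow p b → HasDegree p n → n < b
  DegreeBelow⇒< {b = b} {n} below (lead≉0 , _) with b ℕ.≤? n
  ... | yes b≤n = ⊥-elim (lead≉0 (below n b≤n))
  ... | no  b≰n = ℕ.≰⇒> b≰n

  eval-DegreeBelow-1 : ∀ p x → DegreeBelow p 1 → eval p x ≈ coeff p 0
  eval-DegreeBelow-1 []      x below = refl
  eval-DegreeBelow-1 (a ∷ p) x below =
    trans (+-congˡ (trans (*-congˡ (eval-[] {p} x (λ m → below (suc m) (s≤s z≤n)))) (zeroʳ x))) (+-identityʳ a)

  HasDegree-*ₚ : ∀ p r m n → HasDegree p m → HasDegree r n → HasDegree (p *ₚ r) (m ℕ.+ n)
  HasDegree-*ₚ []      r m       n (lead≉0 , _) _ = ⊥-elim (lead≉0 refl)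
  HasDegree-*ₚ (a ∷ p) r zero    n (a≉0 , above≈0) (r-lead≉0 , r-above≈0) = lead≉0 , high≈0
    where
    coeff-scaled : ∀ j → coeff ((a ∷ p) *ₚ r) j ≈ a * coeff r j
    coeff-scaled zero    = coeff-*ₚ-zero a p r
    coeff-scaled (suc j) = trans (coeff-*ₚ-suc a p r j)
      (trans (+-congˡ (*ₚ-zeroˡ p r (λ m → above≈0 (suc m) (s≤s z≤n)) j)) (+-identityʳ _))
    lead≉0 : ¬ (coeff ((a ∷ p) *ₚ r) n ≈ 0#)
    lead≉0 lead≈0 = r-lead≉0 (x*y≈0⇒y≈0 a≉0 (trans (sym (coeff-scaled n)) lead≈0))
    high≈0 : ∀ j → n < j → coeff ((a ∷ p) *ₚ r) j ≈ 0#
    high≈0 j n<j = trans (coeff-scaled j) (trans (*-congˡ (r-above≈0 j n<j)) (zeroʳ a))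
  HasDegree-*ₚ (a ∷ p) r (suc m) n (lead≉0 , above≈0) r-deg@(_ , r-above≈0) = lead′≉0 , high≈0
    where
    pr-deg : HasDegree (p *ₚ r) (m ℕ.+ n)
    pr-deg = HasDegree-*ₚ p r m n (lead≉0 , λ j m<j → above≈0 (suc j) (s≤s m<j)) r-deg
    coeff-shift : ∀ j → m ℕ.+ n ≤ j → coeff ((a ∷ p) *ₚ r) (suc j) ≈ coeff (p *ₚ r) j
    coeff-shift j m+n≤j = trans (coeff-*ₚ-suc a p r j)
      (trans (+-congʳ (trans (*-congˡ (r-above≈0 (suc j) (s≤s (ℕ.≤-trans (ℕ.m≤n+m n m) m+n≤j)))) (zeroʳ a))) (+-identityˡ _))
    lead′≉0 : ¬ (coeff ((a ∷ p) *ₚ r) (suc (m ℕ.+ n)) ≈ 0#)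
    lead′≉0 lead≈0 = proj₁ pr-deg (trans (sym (coeff-shift _ ℕ.≤-refl)) lead≈0)
    high≈0 : ∀ j → suc (m ℕ.+ n) < j → coeff ((a ∷ p) *ₚ r) j ≈ 0#
    high≈0 (suc j) (s≤s m+n<j) = trans (coeff-shift j (ℕ.<⇒≤ m+n<j)) (proj₂ pr-deg j m+n<j)

  HasDegree-factor : ∀ {p h f m n} → p ≈ₚ h *ₚ f → HasDegree p m → HasDegree f n →
                     ∃ λ l → HasDegree h l × l ℕ.+ n ≡ m
  HasDegree-factor {p} {h} {f} {m} {n} p≈hf p-deg f-deg with ≈[]? h
  ... | yes h≈0 = ⊥-elim (HasDegree⇒≉[] {p} p-deg (≈ₚ-trans {p} {h *ₚ f} {[]} p≈hf (*ₚ-zeroˡ h f h≈0)))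
  ... | no  h≉0 with ≉[]⇒HasDegree h h≉0
  ...   | l , h-deg = l , h-deg ,
          HasDegree-unique {h *ₚ f} (HasDegree-*ₚ h f l n h-deg f-deg) (HasDegree-cong {p} {h *ₚ f} p≈hf p-deg)

  divide-monic : ∀ {f n} → HasDegree f (suc n) → coeff f (suc n) ≈ 1# → ∀ g →
                 ∃₂ λ h rem → g ≈ₚ h *ₚ f +ₚ rem × DegreeBelow rem (suc n)
  divide-monic f-deg f-monic []       = [] , [] , (λ _ → refl) , (λ _ _ → refl)
  divide-monic {f} {n} f-deg@(_ , f-above≈0) f-monic (a ∷ g)
    with divide-monic f-deg f-monic g
  ... | h , rem , g≈hf+rem , rem-below = t ∷ h , rem′ , a∷g≈ , rem′-below
    where
    -- x * rem may reach degree n + 1; cancelling its top coefficient t against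
    -- the monic f brings the remainder back below n + 1.
    t = coeff rem n
    rem′ = (a ∷ rem) -ₚ map (t *_) f
    coeff-rem′ : ∀ m → coeff rem′ m ≈ coeff (a ∷ rem) m - t * coeff f m
    coeff-rem′ m = trans (coeff--ₚ (a ∷ rem) (map (t *_) f) m) (+-congˡ (-‿cong (coeff-scale t f m)))
    cancel : ∀ u y z → (u + y) + (z - u) ≈ y + z
    cancel u y z = begin
      (u + y) + (z - u)   ≈⟨ solve 4 (λ u y z u′ → ((u ⊕ y) ⊕ (z ⊕ u′)) ⊜ ((y ⊕ z) ⊕ (u ⊕ u′))) refl u y z (- u) ⟩
      (y + z) + (u - u)   ≈⟨ +-congˡ (-‿inverseʳ u) ⟩
      (y + z) + 0#        ≈⟨ +-identityʳ _ ⟩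
      y + z               ∎
    a∷g≈ : (a ∷ g) ≈ₚ (t ∷ h) *ₚ f +ₚ rem′
    a∷g≈ zero = sym (begin
      coeff ((t ∷ h) *ₚ f +ₚ rem′) zero          ≈⟨ coeff-+ₚ ((t ∷ h) *ₚ f) rem′ zero ⟩
      coeff ((t ∷ h) *ₚ f) zero + coeff rem′ zero ≈⟨ +-cong (trans (coeff-*ₚ-zero t h f) (sym (+-identityʳ _))) (coeff-rem′ zero) ⟩
      (t * coeff f zero + 0#) + (a - t * coeff f zero) ≈⟨ cancel _ 0# a ⟩
      0# + a                                      ≈⟨ +-identityˡ a ⟩
      a                                           ∎)
    a∷g≈ (suc m) = sym (begin
      coeff ((t ∷ h) *ₚ f +ₚ rem′) (suc m)                ≈⟨ coeff-+ₚ ((t ∷ h) *ₚ f) rem′ (suc m) ⟩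
      coeff ((t ∷ h) *ₚ f) (suc m) + coeff rem′ (suc m)   ≈⟨ +-cong (coeff-*ₚ-suc t h f m) (coeff-rem′ (suc m)) ⟩
      (t * coeff f (suc m) + coeff (h *ₚ f) m) + (coeff rem m - t * coeff f (suc m)) ≈⟨ cancel _ _ _ ⟩
      coeff (h *ₚ f) m + coeff rem m                      ≈⟨ sym (coeff-+ₚ (h *ₚ f) rem m) ⟩
      coeff (h *ₚ f +ₚ rem) m                             ≈⟨ sym (g≈hf+rem m) ⟩
      coeff g m                                           ∎)
    rem′-below : DegreeBelow rem′ (suc n)
    rem′-below (suc m) (s≤s n≤m) with ℕ.m≤n⇒m<n∨m≡n n≤m
    ... | inj₁ n<m    = trans (coeff-rem′ (suc m))
      (x≈y⇒x-y≈0 (trans (rem-below m n<m) (sym (trans (*-congˡ (f-above≈0 (suc m) (s≤s n<m))) (zeroʳ t)))))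
    ... | inj₂ ≡.refl = trans (coeff-rem′ (suc m))
      (x≈y⇒x-y≈0 (sym (trans (*-congˡ f-monic) (*-identityʳ t))))

  remainder≈[]⇒∣ₚ : ∀ {g h f rem} → g ≈ₚ h *ₚ f +ₚ rem → rem ≈ₚ [] → f ∣ₚ g
  remainder≈[]⇒∣ₚ {g} {h} {f} {rem} g≈hf+rem rem≈0 =
    h , λ n → trans (g≈hf+rem n) (trans (coeff-+ₚ (h *ₚ f) rem n) (trans (+-congˡ (rem≈0 n)) (+-identityʳ _)))

  eval-remainder : ∀ {g h f rem} x → g ≈ₚ h *ₚ f +ₚ rem → eval f x ≈ 0# → eval g x ≈ eval rem x
  eval-remainder {g} {h} {f} {rem} x g≈hf+rem fx≈0 = begin
    eval g x                          ≈⟨ eval-cong {g} {h *ₚ f +ₚ rem} x g≈hf+rem ⟩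
    eval (h *ₚ f +ₚ rem) x            ≈⟨ eval-+ₚ (h *ₚ f) rem x ⟩
    eval (h *ₚ f) x + eval rem x      ≈⟨ +-congʳ (trans (eval-*ₚ h f x) (trans (*-congˡ fx≈0) (zeroʳ _))) ⟩
    0# + eval rem x                   ≈⟨ +-identityˡ _ ⟩
    eval rem x                        ∎

  linear : Carrier → Poly
  linear θ = - θ ∷ 1# ∷ []

  HasDegree-linear : ∀ θ → HasDegree (linear θ) 1
  HasDegree-linear θ = 1≉0 , λ { (suc (suc m)) _ → refl ; (suc zero) (s≤s ()) }

  eval-linear : ∀ θ x → eval (linear θ) x ≈ x - θ
  eval-linear θ x = trans (+-congˡ (trans (*-congˡ (eval-const 1# x)) (*-identityʳ x))) (+-comm _ _)

  root⇒linear∣ₚ : ∀ p θ → eval p θ ≈ 0# → linear θ ∣ₚ p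
  root⇒linear∣ₚ p θ pθ≈0 with divide-monic (HasDegree-linear θ) refl p
  ... | h , rem , p≈h*lin+rem , rem-below = remainder≈[]⇒∣ₚ {p} {h} {linear θ} {rem} p≈h*lin+rem rem≈0
    where
    remθ≈0 : eval rem θ ≈ 0#
    remθ≈0 = trans (sym (eval-remainder {p} {h} {linear θ} {rem} θ p≈h*lin+rem (trans (eval-linear θ θ) (-‿inverseʳ θ)))) pθ≈0
    rem≈0 : rem ≈ₚ []
    rem≈0 zero    = trans (sym (eval-DegreeBelow-1 rem θ rem-below)) remθ≈0
    rem≈0 (suc m) = rem-below (suc m) (s≤s z≤n)

  vanishing-at-distinct-points⇒≈[] : ∀ n (pts : Fin n → Carrier) → (∀ i j → pts i ≈ pts j → i ≡ j) →
    ∀ p → DegreeBelow p n → (∀ i → eval p (pts i) ≈ 0#) → p ≈ₚ []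
  vanishing-at-distinct-points⇒≈[] zero    pts pts-inj p below vanishes m = below m z≤n
  vanishing-at-distinct-points⇒≈[] (suc n) pts pts-inj p below vanishes with ≈[]? p
  ... | yes p≈0 = p≈0
  ... | no  p≉0 with ≉[]⇒HasDegree p p≉0 | root⇒linear∣ₚ p (pts Fin.zero) (vanishes Fin.zero)
  ...   | m , p-deg | h , p≈h*lin with HasDegree-factor {p} {h} {linear (pts Fin.zero)} p≈h*lin p-deg (HasDegree-linear _)
  ...     | l , h-deg , l+1≡m = ⊥-elim (HasDegree⇒≉[] {h} h-deg h≈0)
    where
    l<n : l < n
    l<n = ℕ.≤-pred (≡.subst (_< suc n) (≡.trans (≡.sym l+1≡m) (ℕ.+-comm l 1)) (DegreeBelow⇒< {p} below p-deg))
    h-vanishes : ∀ i → eval h (pts (Fin.suc i)) ≈ 0#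
    h-vanishes i = x*y≈0⇒x≈0 linear≉0 (trans (sym (eval-factor {p} {h} {linear _} _ p≈h*lin)) (vanishes (Fin.suc i)))
      where
      linear≉0 : ¬ (eval (linear (pts Fin.zero)) (pts (Fin.suc i)) ≈ 0#)
      linear≉0 lin≈0 with pts-inj _ _ (x-y≈0⇒x≈y (trans (sym (eval-linear _ _)) lin≈0))
      ... | ()
    h≈0 : h ≈ₚ []
    h≈0 = vanishing-at-distinct-points⇒≈[] n (pts ∘ Fin.suc) (λ i j e → Fin.suc-injective (pts-inj _ _ e)) h
            (λ j n≤j → proj₂ h-deg j (ℕ.<-≤-trans l<n n≤j)) h-vanishes

  Monic-HasDegree-0⇒≈1 : ∀ {p} → Monic p → HasDegree p 0 → p ≈ₚ oneₚ
  Monic-HasDegree-0⇒≈1 {p} (n , n-deg , lead≈1) 0-deg with HasDegree-unique {p} n-deg 0-deg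
  ... | ≡.refl = λ { zero → lead≈1 ; (suc m) → proj₂ 0-deg (suc m) (s≤s z≤n) }

  gcd-root⇔ : ∀ {D g f} x → IsMonicGCD D g f → eval f x ≈ 0# → eval D x ≈ 0# ⇔ eval g x ≈ 0#
  gcd-root⇔ {D} {g} {f} x (_ , D∣g , _ , greatest) fx≈0 = mk⇔
    (root-of-factor {g} {D} x D∣g)
    (λ gx≈0 → root-of-factor {D} {linear x} x
      (greatest (linear x) (root⇒linear∣ₚ g x gx≈0) (root⇒linear∣ₚ f x fx≈0))
      (trans (eval-linear x x) (-‿inverseʳ x)))

  eval-≈1 : ∀ {p} x → p ≈ₚ oneₚ → eval p x ≈ 1#
  eval-≈1 {p} x p≈1 = trans (eval-cong {p} {oneₚ} x p≈1) (eval-const 1# x)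

  module SplitSeparable (r′ : ℕ) (f : Poly) (f-deg : HasDegree f (suc r′)) (f-monic : coeff f (suc r′) ≈ 1#)
                        (θ : Fin (suc r′) → Carrier) (θ-injective : ∀ i j → θ i ≈ θ j → i ≡ j)
                        (f-roots : ∀ i → eval f (θ i) ≈ 0#) where

    vanishing-at-roots⇒∣ₚ : ∀ p → (∀ i → eval p (θ i) ≈ 0#) → f ∣ₚ p
    vanishing-at-roots⇒∣ₚ p vanishes with divide-monic f-deg f-monic p
    ... | h , rem , p≈hf+rem , rem-below = remainder≈[]⇒∣ₚ {p} {h} {f} {rem} p≈hf+rem
      (vanishing-at-distinct-points⇒≈[] (suc r′) θ θ-injective rem rem-below rem-vanishes)
      where
      rem-vanishes : ∀ i → eval rem (θ i) ≈ 0#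
      rem-vanishes i = trans (sym (eval-remainder {p} {h} {f} {rem} (θ i) p≈hf+rem (f-roots i))) (vanishes i)

    vanishing-at-roots⇒≥ : ∀ {p n} → HasDegree p n → (∀ i → eval p (θ i) ≈ 0#) → suc r′ ≤ n
    vanishing-at-roots⇒≥ {p} p-deg vanishes with vanishing-at-roots⇒∣ₚ p vanishes
    ... | h , p≈hf with HasDegree-factor {p} {h} {f} p≈hf p-deg f-deg
    ...   | l , _ , l+r≡n = ≡.subst (suc r′ ≤_) l+r≡n (ℕ.m≤n+m (suc r′) l)

    module _ {D n} (D∣f : D ∣ₚ f) (D-deg : HasDegree D n) where

      private
        h : Poly
        h = proj₁ D∣f
        cofactor-degree : ∃ λ l → HasDegree h l × l ℕ.+ n ≡ suc r′
        cofactor-degree = HasDegree-factor {f} {h} {D} (proj₂ D∣f) f-deg D-deg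
        roots-split : ∀ i → eval h (θ i) * eval D (θ i) ≈ 0#
        roots-split i = trans (sym (eval-factor {f} {h} {D} (θ i) (proj₂ D∣f))) (f-roots i)

      divisor-degree-≤ : n ≤ suc r′
      divisor-degree-≤ with l , _ , l+n≡r ← cofactor-degree = ≡.subst (n ≤_) l+n≡r (ℕ.m≤n+m n l)

      -- If D has no root among the θ i, its cofactor has them all, hence full degree.
      vanishing-nowhere⇒degree-0 : (∀ i → ¬ (eval D (θ i) ≈ 0#)) → n ≡ 0
      vanishing-nowhere⇒degree-0 nowhere with l , h-deg , l+n≡r ← cofactor-degree =
        ℕ.n≤0⇒n≡0 (ℕ.+-cancelˡ-≤ l n 0 (ℕ.≤-trans (ℕ.≤-reflexive l+n≡r)
          (ℕ.≤-trans (vanishing-at-roots⇒≥ {h} h-deg (λ i → x*y≈0⇒x≈0 (nowhere i) (roots-split i))) (ℕ.≤-reflexive (≡.sym (ℕ.+-identityʳ l))))))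

      -- A divisor of full degree has a constant (nonzero) cofactor.
      full-degree⇒vanishing-everywhere : n ≡ suc r′ → ∀ i → eval D (θ i) ≈ 0#
      full-degree⇒vanishing-everywhere n≡r i with cofactor-degree
      ... | zero  , h-deg , _     = x*y≈0⇒y≈0 h≉0 (roots-split i)
        where
        h≉0 : ¬ (eval h (θ i) ≈ 0#)
        h≉0 h≈0 = proj₁ h-deg (trans (sym (eval-DegreeBelow-1 h (θ i) (proj₂ h-deg))) h≈0)
      ... | suc l , _     , l+n≡r with () ← ℕ.+-cancelʳ-≡ n (suc l) 0 (≡.trans l+n≡r (≡.sym n≡r))

    everywhere⇔∣ₚ : ∀ {g p} (P : Fin (suc r′) → Set p) → (∀ i → P i ⇔ eval g (θ i) ≈ 0#) →
                    (∀ i → P i) ⇔ f ∣ₚ g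
    everywhere⇔∣ₚ {g} P P⇔root = mk⇔
      (λ all → vanishing-at-roots⇒∣ₚ g (λ i → Equivalence.to (P⇔root i) (all i)))
      (λ f∣g i → Equivalence.from (P⇔root i) (root-of-factor {g} {f} (θ i) f∣g (f-roots i)))

    module _ {D} (D-monic : Monic D) (D∣f : D ∣ₚ f)
             {p} (P : Fin (suc r′) → Set p) (P⇔root : ∀ i → P i ⇔ eval D (θ i) ≈ 0#) where

      private
        n = proj₁ D-monic
        D-deg : HasDegree D n
        D-deg = proj₁ (proj₂ D-monic)

      nowhere⇔≈1 : (∀ i → ¬ P i) ⇔ D ≈ₚ oneₚ
      nowhere⇔≈1 = mk⇔
        (λ nowhere → Monic-HasDegree-0⇒≈1 {D} D-monic
          (≡.subst (HasDegree D) (vanishing-nowhere⇒degree-0 D∣f D-deg (λ i → nowhere i ∘ Equivalence.from (P⇔root i))) D-deg))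
        (λ D≈1 i Pi → 1≉0 (trans (sym (eval-≈1 {D} (θ i) D≈1)) (Equivalence.to (P⇔root i) Pi)))

      somewhere-not-everywhere⇔NonTrivialDeg : (∃₂ λ i j → P i × ¬ P j) ⇔ NonTrivialDeg D (suc r′)
      somewhere-not-everywhere⇔NonTrivialDeg = mk⇔ to from
        where
        to : (∃₂ λ i j → P i × ¬ P j) → NonTrivialDeg D (suc r′)
        to (i , j , Pi , ¬Pj) = n , D-deg , ℕ.n≢0⇒n>0 n≢0 , ℕ.≤∧≢⇒< (divisor-degree-≤ D∣f D-deg) n≢r
          where
          n≢0 : n ≢ 0
          n≢0 n≡0 = Equivalence.from nowhere⇔≈1 (Monic-HasDegree-0⇒≈1 {D} D-monic (≡.subst (HasDegree D) n≡0 D-deg)) i Pi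
          n≢r : n ≢ suc r′
          n≢r n≡r = ¬Pj (Equivalence.from (P⇔root j) (full-degree⇒vanishing-everywhere D∣f D-deg n≡r j))
        P? : ∀ i → Dec (P i)
        P? i = Dec.map (⇔.sym (P⇔root i)) (eval D (θ i) ≟ 0#)
        from : NonTrivialDeg D (suc r′) → ∃₂ λ i j → P i × ¬ P j
        from (m , m-deg , 0<m , m<r) with Fin.any? P? | Fin.any? (¬? ∘ P?)
        ... | yes (i , Pi) | yes (j , ¬Pj) = i , j , Pi , ¬Pj
        ... | no  ∄P       | _             = ⊥-elim (ℕ.<⇒≢ 0<m (≡.sym (vanishing-nowhere⇒degree-0 D∣f m-deg
          (λ i Di≈0 → ∄P (i , Equivalence.from (P⇔root i) Di≈0)))))
        ... | yes _        | no  ∄¬P       = ⊥-elim (ℕ.<⇒≱ m<r (vanishing-at-roots⇒≥ {D} m-deg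
          (λ i → Equivalence.to (P⇔root i) (decidable-stable (P? i) (λ ¬Pi → ∄¬P (i , ¬Pi))))))

  primitive-root-powers-injective : ∀ {ρ r′} → IsPrimitiveRoot ρ (suc r′) → ∀ i j → i < suc r′ → j < suc r′ →
                                    pow ρ i ≈ pow ρ j → i ≡ j
  primitive-root-powers-injective {ρ} {r′} (ρʳ≈1 , no-smaller-order) = injective
    where
    r = suc r′
    ρ≉0 : ¬ (ρ ≈ 0#)
    ρ≉0 ρ≈0 = 1≉0 (trans (sym ρʳ≈1) (trans (*-congʳ ρ≈0) (zeroˡ _)))
    <⇒≉ : ∀ {i j} → i < j → j < r → ¬ (pow ρ i ≈ pow ρ j)
    <⇒≉ {i} {j} i<j j<r ρⁱ≈ρʲ = no-smaller-order (j ∸ i) (ℕ.m<n⇒0<n∸m i<j) (ℕ.≤-<-trans (ℕ.m∸n≤m j i) j<r)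
      (sym (*-cancelʳ-≉0 (pow-≉0 i ρ≉0) (begin
        1# * pow ρ i              ≈⟨ *-identityˡ _ ⟩
        pow ρ i                   ≈⟨ ρⁱ≈ρʲ ⟩
        pow ρ j                   ≡⟨ ≡.cong (pow ρ) (≡.sym (ℕ.m∸n+n≡m (ℕ.<⇒≤ i<j))) ⟩
        pow ρ (j ∸ i ℕ.+ i)       ≈⟨ pow-+ ρ (j ∸ i) i ⟩
        pow ρ (j ∸ i) * pow ρ i   ∎)))
    injective : ∀ i j → i < r → j < r → pow ρ i ≈ pow ρ j → i ≡ j
    injective i j i<r j<r ρⁱ≈ρʲ with ℕ.<-cmp i j
    ... | tri< i<j _ _ = ⊥-elim (<⇒≉ i<j j<r ρⁱ≈ρʲ)
    ... | tri≈ _ i≡j _ = i≡j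
    ... | tri> _ _ j<i = ⊥-elim (<⇒≉ j<i i<r (sym ρⁱ≈ρʲ))

  eval-XrMinus : ∀ r β x → eval (XrMinus r β) x ≈ pow x r - β
  eval-XrMinus r β x = trans (eval--ₚ (Xpow r) (β ∷ []) x) (+-cong (eval-Xpow r x) (-‿cong (eval-const β x)))

  coeff-XrMinus-suc : ∀ r β m → coeff (XrMinus (suc r) β) (suc m) ≈ coeff (Xpow (suc r)) (suc m)
  coeff-XrMinus-suc r β m = trans (coeff--ₚ (Xpow (suc r)) (β ∷ []) (suc m)) (trans (+-congˡ -0#≈0#) (+-identityʳ _))

  coeff-Xpow-self : ∀ n → coeff (Xpow n) n ≡ 1#
  coeff-Xpow-self zero    = ≡.refl
  coeff-Xpow-self (suc n) = coeff-Xpow-self n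

  coeff-Xpow-> : ∀ n m → n < m → coeff (Xpow n) m ≡ 0#
  coeff-Xpow-> zero    (suc m) _         = ≡.refl
  coeff-Xpow-> (suc n) (suc m) (s≤s n<m) = coeff-Xpow-> n m n<m

  XrMinus-monic : ∀ r β → coeff (XrMinus (suc r) β) (suc r) ≈ 1#
  XrMinus-monic r β = trans (coeff-XrMinus-suc r β r) (reflexive (coeff-Xpow-self r))

  HasDegree-XrMinus : ∀ r β → HasDegree (XrMinus (suc r) β) (suc r)
  HasDegree-XrMinus r β = (λ lead≈0 → 1≉0 (trans (sym (XrMinus-monic r β)) lead≈0)) ,
    λ { (suc m) r<m → trans (coeff-XrMinus-suc r β m) (reflexive (coeff-Xpow-> (suc r) (suc m) r<m)) }

  eval-gak : ∀ ρ a k x → eval (gak ρ a k) x ≈ pow (a - x) k - pow (a - ρ * x) k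
  eval-gak ρ a k x = trans (eval--ₚ (powₚ (a ∷ - 1# ∷ []) k) (powₚ (a ∷ - ρ ∷ []) k) x)
    (+-cong (trans (eval-powₚ _ k x) (pow-cong k (trans (eval-affine 1#) (+-congˡ (-‿cong (*-identityˡ x))))))
            (-‿cong (trans (eval-powₚ _ k x) (pow-cong k (eval-affine ρ)))))
    where
    eval-affine : ∀ b → eval (a ∷ - b ∷ []) x ≈ a - b * x
    eval-affine b = +-congˡ (trans (*-congˡ (eval-const (- b) x)) (trans (sym (-‿distribʳ-* x b)) (-‿cong (*-comm x b))))

  module RootsOfXʳ-αʳ (r′ : ℕ) {ρ α} (ρ-prim : IsPrimitiveRoot ρ (suc r′)) (α≉0 : ¬ (α ≈ 0#)) where

    θ : Fin (suc r′) → Carrier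
    θ i = pow ρ (toℕ i) * α

    pow-ρⁱα : ∀ i → pow (pow ρ i * α) (suc r′) ≈ pow α (suc r′)
    pow-ρⁱα i = begin
      pow (pow ρ i * α) (suc r′)              ≈⟨ pow-distrib-* (pow ρ i) α (suc r′) ⟩
      pow (pow ρ i) (suc r′) * pow α (suc r′) ≈⟨ *-congʳ (pow-* ρ i (suc r′)) ⟩
      pow ρ (i ℕ.* suc r′) * pow α (suc r′)   ≡⟨ ≡.cong (λ m → pow ρ m * pow α (suc r′)) (ℕ.*-comm i (suc r′)) ⟩
      pow ρ (suc r′ ℕ.* i) * pow α (suc r′)   ≈⟨ *-congʳ (sym (pow-* ρ (suc r′) i)) ⟩
      pow (pow ρ (suc r′)) i * pow α (suc r′) ≈⟨ *-congʳ (trans (pow-cong i (proj₁ ρ-prim)) (pow-1 i)) ⟩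
      1# * pow α (suc r′)                     ≈⟨ *-identityˡ _ ⟩
      pow α (suc r′)                          ∎

    θ-injective : ∀ i j → θ i ≈ θ j → i ≡ j
    θ-injective i j θi≈θj = Fin.toℕ-injective (primitive-root-powers-injective ρ-prim (toℕ i) (toℕ j)
      (Fin.toℕ<n i) (Fin.toℕ<n j) (*-cancelʳ-≉0 α≉0 θi≈θj))

    θ-roots : ∀ i → eval (XrMinus (suc r′) (pow α (suc r′))) (θ i) ≈ 0#
    θ-roots i = trans (eval-XrMinus (suc r′) _ (θ i)) (x≈y⇒x-y≈0 (pow-ρⁱα (toℕ i)))

    open SplitSeparable r′ (XrMinus (suc r′) (pow α (suc r′))) (HasDegree-XrMinus r′ (pow α (suc r′)))
                        (XrMinus-monic r′ (pow α (suc r′))) θ θ-injective θ-roots public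

    gak-root⇔ : ∀ {a} k → ¬ (pow a (suc r′) ≈ pow α (suc r′)) → ∀ i →
                eval (gak ρ a k) (θ i) ≈ 0# ⇔ pow (cc ρ α a (toℕ i)) k ≈ 1#
    gak-root⇔ {a} k aʳ≉αʳ i = ⇔.trans (≈0⇔≈0 eval-gθ) (⇔.trans x-y≈0⇔x≈y (⇔.sym (pow-ratio≈1⇔ k v≉0)))
      where
      eval-gθ : eval (gak ρ a k) (θ i) ≈ pow (a - θ i) k - pow (a - pow ρ (suc (toℕ i)) * α) k
      eval-gθ = trans (eval-gak ρ a k (θ i)) (+-congˡ (-‿cong (pow-cong k (+-congˡ (-‿cong (sym (*-assoc ρ _ α)))))))
      v≉0 : ¬ (a - pow ρ (suc (toℕ i)) * α ≈ 0#)
      v≉0 v≈0 = aʳ≉αʳ (trans (pow-cong (suc r′) (x-y≈0⇒x≈y v≈0)) (pow-ρⁱα (suc (toℕ i))))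
      ≈0⇔≈0 : ∀ {x y} → x ≈ y → (x ≈ 0#) ⇔ (y ≈ 0#)
      ≈0⇔≈0 x≈y = mk⇔ (trans (sym x≈y)) (trans x≈y)

lemma3p2 : ∀ {c ℓ} (F : FiniteField c ℓ) →
    let open FF F in
    (r : ℕ) → Prime r → r ∣ (q ∸ 1) →
    (ρ : Carrier) → IsPrimitiveRoot ρ r →
    (α : Carrier) → ¬ (α ≈ 0#) →
    (a : Carrier) → ¬ (pow a r ≈ pow α r) →
    (d : Fin r → ℕ) → (∀ i → IsMultOrder (cc ρ α a (toℕ i)) (d i)) →
    (k : ℕ) → 0 < k →
    (D : Poly) → IsMonicGCD D (gak ρ a k) (XrMinus r (pow α r)) →
      ((∀ i → d i ∣ k) ⇔ (XrMinus r (pow α r) ∣ₚ gak ρ a k))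
      × ((∃₂ λ i j → d i ∣ k × ¬ (d j ∣ k)) ⇔ NonTrivialDeg D r)
      × ((∀ i → ¬ (d i ∣ k)) ⇔ (D ≈ₚ oneₚ))
-- Primality of r is used only through r ≠ 0.
lemma3p2 F zero     r-prime = ⊥-elim (¬prime[0] r-prime)
lemma3p2 F (suc r′) _ _ ρ ρ-prim α α≉0 a aʳ≉αʳ d d-order k _ D D-gcd@(D-monic , _ , D∣f , _) =
    everywhere⇔∣ₚ {gak ρ a k} (λ i → d i ∣ k) d∣k⇔g-root
  , somewhere-not-everywhere⇔NonTrivialDeg D-monic D∣f (λ i → d i ∣ k) d∣k⇔D-root
  , nowhere⇔≈1 D-monic D∣f (λ i → d i ∣ k) d∣k⇔D-root
  where
  open FF F hiding (zero)
  open Polynomials F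
  open RootsOfXʳ-αʳ r′ ρ-prim α≉0

  d∣k⇔g-root : ∀ i → d i ∣ k ⇔ eval (gak ρ a k) (θ i) ≈ 0#
  d∣k⇔g-root i = ⇔.trans (∣⇔pow≈1 k (d-order i)) (⇔.sym (gak-root⇔ k aʳ≉αʳ i))

  d∣k⇔D-root : ∀ i → d i ∣ k ⇔ eval D (θ i) ≈ 0#
  d∣k⇔D-root i = ⇔.trans (d∣k⇔g-root i) (⇔.sym (gcd-root⇔ {D} {gak ρ a k} {XrMinus (suc r′) (pow α (suc r′))} (θ i) D-gcd (θ-roots i)))
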